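{- For every integer $k\ge 4$, the path $P_k$ defines the graph $K_2$; that is, there is a coalition partition $\Psi$ of $P_k$ with $\mathrm{CG}(P_k,\Psi)\cong K_2$.
   Context: For a graph $G$ with vertex set $V$, a set $S\subseteq V$ is a dominating set if every vertex of $V\setminus S$ is adjacent to a vertex of $S$. Two disjoint sets $V_1,V_2\subseteq V$ form a coalition in $G$ if neither is a dominating set of $G$ but $V_1\cup V_2$ is. A coalition partition of $G$ is a partition $\Psi=\{V_1,\ldots,V_k\}$ of $V$ such that every $V_i\in\Psi$ is either a dominating set of $G$ with $|V_i|=1$, or is not a dominating set and forms a coalition with some $V_j\in\Psi$. Given a coalition partition $\Psi$ of $G$, the coalition graph $\mathrm{CG}(G,\Psi)$ has vertex set $\Psi$, two members adjacent iff they form a coalition in $G$. $P_k$ is the path on $k$ vertices; it defines a graph $H$ if some coalition partition $\Psi$ of $P_k$ has $\mathrm{CG}(P_k,\Psi)\cong H$. -}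

module Defs where

open import Data.Nat using (ℕ; suc)
open import Data.Fin using (Fin; toℕ)
open import Data.Product using (Σ; ∃; _×_; _,_)
open import Data.Sum using (_⊎_)
open import Relation.Nullary using (¬_)
open import Data.Empty using (⊥)
open import Relation.Binary.PropositionalEquality using (_≡_; _≢_)
open import Function.Bundles using (_⤖_; _⇔_; Bijection)

Graph : ℕ → Set₁
Graph n = Fin n → Fin n → Set

Path : (k : ℕ) → Graph k
Path k i j = (suc (toℕ i) ≡ toℕ j) ⊎ (suc (toℕ j) ≡ toℕ i)

K₂ : Graph 2
K₂ i j = i ≢ j

VSet : ℕ → Set₁
VSet n = Fin n → Set

_∪_ : ∀ {n} → VSet n → VSet n → VSet n
(A ∪ B) v = A v ⊎ B v

Disjoint : ∀ {n} → VSet n → VSet n → Set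
Disjoint A B = ∀ v → A v → B v → ⊥

Dominating : ∀ {n} → Graph n → VSet n → Set
Dominating {n} G S = ∀ v → S v ⊎ (Σ (Fin n) λ u → S u × G u v)

Singleton : ∀ {n} → VSet n → Set
Singleton {n} S = Σ (Fin n) λ v → ∀ u → (S u ⇔ (u ≡ v))

FormCoalition : ∀ {n} → Graph n → VSet n → VSet n → Set
FormCoalition G A B =
  Disjoint A B × ¬ Dominating G A × ¬ Dominating G B × Dominating G (A ∪ B)

-- A partition of Fin n into m (nonempty) classes, given by a surjective
-- class-assignment c : Fin n → Fin m; class i is {v | c v ≡ i}.
Class : ∀ {n m} → (Fin n → Fin m) → Fin m → VSet n
Class c i v = c v ≡ i

IsPartition : ∀ {n m} → (Fin n → Fin m) → Set
IsPartition {n} c = ∀ i → Σ (Fin n) λ v → c v ≡ i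

IsCoalitionPartition : ∀ {n m} → Graph n → (Fin n → Fin m) → Set
IsCoalitionPartition {n} {m} G c =
  IsPartition c ×
  (∀ i → (Dominating G (Class c i) × Singleton (Class c i))
         ⊎ (¬ Dominating G (Class c i) ×
            Σ (Fin m) λ j → FormCoalition G (Class c i) (Class c j)))

CoalitionGraph : ∀ {n m} → Graph n → (Fin n → Fin m) → Graph m
CoalitionGraph G c i j = FormCoalition G (Class c i) (Class c j)

_≅_ : ∀ {m p} → Graph m → Graph p → Set
_≅_ {m} {p} G H =
  Σ (Fin m ⤖ Fin p) λ σ →
    ∀ i j → G i j ⇔ H (Bijection.to σ i) (Bijection.to σ j)

Defines : ∀ {k p} → Graph k → Graph p → Set
Defines {k} G H =
  Σ ℕ λ m → Σ (Fin k → Fin m) λ c → IsCoalitionPartition G c × (CoalitionGraph G c ≅ H)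

-- Split P_k into the initial segment {0, 1} and the rest. The segment cannot dominate the
-- last vertex, whose neighbourhood lies beyond vertex 2 once k ≥ 4, and the rest cannot
-- dominate vertex 0; their union is everything. A partition into two non-dominating classes
-- is a coalition partition whose only coalition is the pair of classes, i.e. CG ≅ K₂.
module Submission where

open import Defs
open import Data.Nat using (ℕ; suc; _≤_; _<_; _<?_; s≤s; z≤n)
open import Data.Nat.Properties using (<⇒≱; <-asym; <-irrefl; ≤-trans)
open import Data.Fin using (Fin; toℕ; fromℕ) renaming (zero to fz; suc to fs)
open import Data.Fin.Properties using (toℕ-fromℕ; toℕ<n)
open import Data.Product using (Σ; _×_; _,_)
open import Data.Sum using (_⊎_; inj₁; inj₂; swap)
open import Data.Empty using (⊥-elim)
open import Relation.Nullary using (¬_; yes; no)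
open import Relation.Binary.PropositionalEquality using (_≡_; _≢_; refl; sym; trans; cong; subst)
open import Function.Bundles using (mk⇔)
open import Function.Construct.Identity using (⤖-id)

FormCoalition-sym : ∀ {n} {G : Graph n} {A B : VSet n} →
                    FormCoalition G A B → FormCoalition G B A
FormCoalition-sym {n} {G} {A} {B} (disjoint , ¬domA , ¬domB , domA∪B) =
  (λ v b a → disjoint v a b) , ¬domB , ¬domA , λ v → swap-dominated (domA∪B v)
  where
  swap-dominated : ∀ {v} → (A ∪ B) v ⊎ Σ (Fin n) (λ u → (A ∪ B) u × G u v)
                         → (B ∪ A) v ⊎ Σ (Fin n) (λ u → (B ∪ A) u × G u v)
  swap-dominated (inj₁ a∪b)              = inj₁ (swap a∪b)
  swap-dominated (inj₂ (u , a∪b , edge)) = inj₂ (u , swap a∪b , edge)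

Class-disjoint : ∀ {n m} (c : Fin n → Fin m) {i j} → i ≢ j → Disjoint (Class c i) (Class c j)
Class-disjoint c i≢j v cv≡i cv≡j = i≢j (trans (sym cv≡i) cv≡j)

-- Classes of a partition are nonempty, so a class cannot be disjoint from itself.
FormCoalition⇒≢ : ∀ {n m} {G : Graph n} {c : Fin n → Fin m} → IsPartition c →
                  ∀ {i j} → FormCoalition G (Class c i) (Class c j) → i ≢ j
FormCoalition⇒≢ partition {i} (disjoint , _) refl with partition i
... | v , cv≡i = disjoint v cv≡i cv≡i

module TwoClasses {n} (G : Graph n) (c : Fin n → Fin 2) (partition : IsPartition c)
                  (¬dom₀ : ¬ Dominating G (Class c fz))
                  (¬dom₁ : ¬ Dominating G (Class c (fs fz))) where

  classes-cover : ∀ v → (Class c fz ∪ Class c (fs fz)) v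
  classes-cover v with c v
  ... | fz    = inj₁ refl
  ... | fs fz = inj₂ refl

  coalition : FormCoalition G (Class c fz) (Class c (fs fz))
  coalition = Class-disjoint c (λ ()) , ¬dom₀ , ¬dom₁ , λ v → inj₁ (classes-cover v)

  ≢⇒FormCoalition : ∀ i j → i ≢ j → FormCoalition G (Class c i) (Class c j)
  ≢⇒FormCoalition fz    fz    i≢j = ⊥-elim (i≢j refl)
  ≢⇒FormCoalition fz    (fs fz) _ = coalition
  ≢⇒FormCoalition (fs fz) fz    _ = FormCoalition-sym coalition
  ≢⇒FormCoalition (fs fz) (fs fz) i≢j = ⊥-elim (i≢j refl)

  isCoalitionPartition : IsCoalitionPartition G c
  isCoalitionPartition = partition , λ
    { fz      → inj₂ (¬dom₀ , fs fz , coalition)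
    ; (fs fz) → inj₂ (¬dom₁ , fz , FormCoalition-sym coalition) }

  coalitionGraph≅K₂ : CoalitionGraph G c ≅ K₂
  coalitionGraph≅K₂ = ⤖-id (Fin 2) , λ i j →
    mk⇔ (FormCoalition⇒≢ partition) (≢⇒FormCoalition i j)

cut : ∀ {k} → ℕ → Fin k → Fin 2
cut t v with toℕ v <? t
... | yes _ = fz
... | no  _ = fs fz

cut-lower : ∀ {k} t (v : Fin k) → cut t v ≡ fz → toℕ v < t
cut-lower t v with toℕ v <? t
... | yes v<t = λ _ → v<t
... | no  _   = λ ()

cut-upper : ∀ {k} t (v : Fin k) → cut t v ≡ fs fz → ¬ toℕ v < t
cut-upper t v with toℕ v <? t
... | yes _   = λ ()
... | no  v≮t = λ _ → v≮t

module PathCut (m t : ℕ) (2≤t : 2 ≤ t) (t<m : t < m) where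

  last : Fin (suc m)
  last = fromℕ m

  cut-last : cut t last ≡ fs fz
  cut-last with toℕ last <? t
  ... | yes last<t = ⊥-elim (<-asym t<m (subst (_< t) (toℕ-fromℕ m) last<t))
  ... | no  _      = refl

  cut-zero : cut t (fz {m}) ≡ fz
  cut-zero with 0 <? t
  ... | yes _ = refl
  ... | no  0≮t = ⊥-elim (0≮t (≤-trans (s≤s z≤n) 2≤t))

  isPartition : IsPartition (cut {suc m} t)
  isPartition fz      = fz , cut-zero
  isPartition (fs fz) = last , cut-last

  -- The neighbours of the last vertex m are m - 1 ≥ t and nothing above m.
  ¬dom-lower : ¬ Dominating (Path (suc m)) (Class (cut t) fz)
  ¬dom-lower dom with dom last | toℕ-fromℕ m
  ... | inj₁ last-lower | last≡m =
    <-asym t<m (subst (_< t) last≡m (cut-lower t last last-lower))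
  ... | inj₂ (u , u-lower , inj₁ 1+u≡last) | last≡m =
    <⇒≱ t<m (subst (_≤ t) (trans 1+u≡last last≡m) (cut-lower t u u-lower))
  ... | inj₂ (u , _ , inj₂ 1+last≡u) | last≡m =
    <-irrefl refl (subst (_< suc m) (trans (sym 1+last≡u) (cong suc last≡m)) (toℕ<n u))

  -- The only neighbour of vertex 0 is vertex 1 < t.
  ¬dom-upper : ¬ Dominating (Path (suc m)) (Class (cut t) (fs fz))
  ¬dom-upper dom with dom fz
  ... | inj₁ zero-upper = cut-upper t fz zero-upper (≤-trans (s≤s z≤n) 2≤t)
  ... | inj₂ (u , _ , inj₁ ())
  ... | inj₂ (u , u-upper , inj₂ 1≡u) = cut-upper t u u-upper (subst (_< t) 1≡u 2≤t)

  open TwoClasses (Path (suc m)) (cut t) isPartition ¬dom-lower ¬dom-upper public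

proposition4 : (k : ℕ) → 4 ≤ k → Defines (Path k) K₂
proposition4 (suc m) (s≤s 3≤m) =
  2 , cut 2 , isCoalitionPartition , coalitionGraph≅K₂
  where open PathCut m 2 (s≤s (s≤s z≤n)) 3≤m
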